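{- For every $n,m\geq 1$, $\chi'_{sCF}(K_{n,m})\leq 2$.
   Context: For a graph $H$ and a vertex $v$, let $E_H(v)$ be the set of edges of $H$ incident to $v$, and for a pair $u,v$ let $E_H[uv]=E_H(u)\cup E_H(v)$. Given a graph $G$ and an edge colouring $c$ (not necessarily proper) of some subgraph $H$ of $G$, an edge $e$ of $G$ is satisfied by $c$ if the multiset $\{c(e'): e'\in E_H[e]\}$ contains a colour occurring exactly once in it. The parameter $\chi'_{sCF}(G)$ is the least number of colours for which there exist a subgraph $H$ of $G$ and an edge colouring of $H$ with that many colours satisfying every edge of $G$. -}

module Defs where

open import Data.Nat using (ℕ)
open import Data.Fin using (Fin)
open import Data.Maybe using (Maybe; just; nothing)
open import Data.Product using (Σ; ∃; _×_; _,_; proj₁; proj₂)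
open import Data.Sum using (_⊎_)
open import Relation.Binary.PropositionalEquality using (_≡_)

record Graph : Set₁ where
  field
    V    : Set
    E    : Set
    ends : E → V × V
open Graph public

IncidentTo : (G : Graph) → E G → V G → Set
IncidentTo G e v = (proj₁ (ends G e) ≡ v) ⊎ (proj₂ (ends G e) ≡ v)

-- A colouring with k colours of a (spanning) subgraph H of G:
-- c e ≡ nothing means e ∉ E(H); c e ≡ just a means e ∈ E(H) with colour a.
-- (Isolated vertices of H play no role, so spanning subgraphs suffice.)
PartialColouring : Graph → ℕ → Set
PartialColouring G k = E G → Maybe (Fin k)

InNbhd : (G : Graph) {k : ℕ} → PartialColouring G k → E G → E G → Fin k → Set
InNbhd G c e e' a =
  (c e' ≡ just a) × (IncidentTo G e' (proj₁ (ends G e)) ⊎ IncidentTo G e' (proj₂ (ends G e)))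

Satisfied : (G : Graph) {k : ℕ} → PartialColouring G k → E G → Set
Satisfied G c e =
  Σ (E G) λ e' → Σ _ λ a →
    InNbhd G c e e' a × (∀ e'' → InNbhd G c e e'' a → e'' ≡ e')

χ'sCF≤ : Graph → ℕ → Set
χ'sCF≤ G k = Σ (PartialColouring G k) λ c → ∀ e → Satisfied G c e

K : ℕ → ℕ → Graph
K n m = record
  { V    = Fin n ⊎ Fin m
  ; E    = Fin n × Fin m
  ; ends = λ { (i , j) → (Data.Sum.inj₁ i , Data.Sum.inj₂ j) }
  }

{-# OPTIONS --safe #-}
module Submission where

open import Defs
open import Data.Nat using (ℕ; _≥_; suc)
open import Data.Fin using (Fin; zero; suc)
open import Data.Maybe using (just; nothing)
open import Data.Product using (_,_)
open import Data.Sum using (inj₁; inj₂)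
open import Relation.Binary.PropositionalEquality using (_≡_; refl)

-- Let H be the star of K_{n,m} centred at the left vertex 0, with its edge to
-- the right vertex 0 coloured 1 and all other edges coloured 0.  An edge at the
-- centre sees the whole star, where colour 1 occurs exactly once; any other edge
-- i j sees no edge of H at i, so E_H[ij] is the single star edge 0 j.

starColour : ∀ {m} → Fin (suc m) → Fin 2
starColour zero    = suc zero
starColour (suc _) = zero

starColouring : ∀ {n m} → PartialColouring (K (suc n) (suc m)) 2
starColouring (zero  , j) = just (starColour j)
starColouring (suc _ , _) = nothing

module _ {n m : ℕ} where

  private
    G = K (suc n) (suc m)

  centreEdge-satisfied : ∀ j → Satisfied G starColouring (zero , j)
  centreEdge-satisfied j = (zero , zero) , suc zero , (refl , inj₁ (inj₁ refl)) , unique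
    where
    unique : ∀ e → InNbhd G starColouring (zero , j) e (suc zero) → e ≡ (zero , zero)
    unique (zero  , zero)  _        = refl
    unique (zero  , suc _) (() , _)
    unique (suc _ , _)     (() , _)

  offCentreEdge-satisfied : ∀ i j → Satisfied G starColouring (suc i , j)
  offCentreEdge-satisfied i j =
    (zero , j) , starColour j , (refl , inj₂ (inj₂ refl)) , unique
    where
    unique : ∀ e → InNbhd G starColouring (suc i , j) e (starColour j) → e ≡ (zero , j)
    unique (suc _ , _) (() , _)
    unique (zero  , _) (_ , inj₁ (inj₁ ()))
    unique (zero  , _) (_ , inj₁ (inj₂ ()))
    unique (zero  , _) (_ , inj₂ (inj₁ ()))
    unique (zero  , _) (_ , inj₂ (inj₂ refl)) = refl

  starColouring-satisfies : ∀ e → Satisfied G starColouring e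
  starColouring-satisfies (zero  , j) = centreEdge-satisfied j
  starColouring-satisfies (suc i , j) = offCentreEdge-satisfied i j

mainTheorem8 : (n m : ℕ) → n ≥ 1 → m ≥ 1 → χ'sCF≤ (K n m) 2
mainTheorem8 (suc n) (suc m) _ _ = starColouring , starColouring-satisfies
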